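{- Let $\mathbf{L}=\langle L,\leq\rangle$ be a complete lattice, $S$ an $L$-parameterization, and $C\colon L\to L$ an $S$-closure operator in $\mathbf{L}$. Then for all $a\in L$ and all $\langle f,h\rangle\in S$: $$f(C(a))\leq C(f(a)),\qquad C(h(a))\leq h(C(a)),\qquad f(C(h(a)))\leq h(C(f(a))).$$
   Context: An isotone Galois connection in $\mathbf{L}$ is a pair $\langle f,h\rangle$ of maps $L\to L$ with $f(a)\leq b$ iff $a\leq h(b)$. An $L$-parameterization is a set $S$ of isotone Galois connections containing $\langle\mathrm{id},\mathrm{id}\rangle$. An $S$-closure operator is $C\colon L\to L$ with $a\leq C(a)$, $a\leq b$ implies $C(a)\leq C(b)$, and $C(h(C(a)))\leq h(C(a))$ for all $a,b\in L$ and $\langle f,h\rangle\in S$. -}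

module Defs where

open import Level using (Level; suc; _⊔_)
open import Data.Product using (_×_; _,_; proj₁; proj₂)
open import Relation.Unary using (Pred; _∈_)
open import Relation.Binary.Bundles using (Poset)
open import Function using (id)

-- A complete lattice: a poset in which every subset (predicate on the
-- carrier) has a least upper bound.  (Existence of all joins implies
-- existence of all meets, so this is the usual notion.)
record CompleteLattice (c ℓ₁ ℓ₂ : Level) : Set (suc (c ⊔ ℓ₁ ⊔ ℓ₂)) where
  field
    poset : Poset c ℓ₁ ℓ₂
  open Poset poset public
  field
    ⋁        : Pred Carrier c → Carrier
    ⋁-upper  : (X : Pred Carrier c) → ∀ x → x ∈ X → x ≤ ⋁ X
    ⋁-least  : (X : Pred Carrier c) → ∀ z → (∀ x → x ∈ X → x ≤ z) → ⋁ X ≤ z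

module _ {c ℓ₁ ℓ₂ : Level} (𝐋 : CompleteLattice c ℓ₁ ℓ₂) where
  open CompleteLattice 𝐋

  Pair : Set c
  Pair = (Carrier → Carrier) × (Carrier → Carrier)

  IsIsotoneGalois : Pair → Set (c ⊔ ℓ₂)
  IsIsotoneGalois (f , h) =
    ∀ a b → (f a ≤ b → a ≤ h b) × (a ≤ h b → f a ≤ b)

  record IsParameterization {ℓS : Level} (S : Pred Pair ℓS) : Set (c ⊔ ℓ₂ ⊔ ℓS) where
    field
      galois : ∀ p → p ∈ S → IsIsotoneGalois p
      has-id : (id , id) ∈ S

  record IsSClosure {ℓS : Level} (S : Pred Pair ℓS) (C : Carrier → Carrier)
         : Set (c ⊔ ℓ₂ ⊔ ℓS) where
    field
      extensive : ∀ a → a ≤ C a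
      monotone  : ∀ a b → a ≤ b → C a ≤ C b
      closed    : ∀ a f h → (f , h) ∈ S → C (h (C a)) ≤ h (C a)

module Submission where

open import Defs
open import Level using (Level)
open import Data.Product using (_×_; _,_; proj₁; proj₂)
open import Relation.Unary using (Pred; _∈_)

-- Idea: h (C b) is C-closed for every ⟨f , h⟩ ∈ S, so anything below it has
-- its closure below it too.  Taking b = f a and using a ≤ h (f a) ≤ h (C (f a))
-- gives C a ≤ h (C (f a)); the three inequalities are its adjoint form, its
-- instance at h a with f (h a) ≤ a, and their composite.

module _ {c ℓ₁ ℓ₂ : Level} (𝐋 : CompleteLattice c ℓ₁ ℓ₂) where
  open CompleteLattice 𝐋

  module IsotoneGalois {f h : Carrier → Carrier}
                       (galois : IsIsotoneGalois 𝐋 (f , h)) where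

    transposeˡ : ∀ {a b} → a ≤ h b → f a ≤ b
    transposeˡ {a} {b} = proj₂ (galois a b)

    transposeʳ : ∀ {a b} → f a ≤ b → a ≤ h b
    transposeʳ {a} {b} = proj₁ (galois a b)

    unit : ∀ a → a ≤ h (f a)
    unit a = transposeʳ refl

    counit : ∀ b → f (h b) ≤ b
    counit b = transposeˡ refl

    f-mono : ∀ {a b} → a ≤ b → f a ≤ f b
    f-mono {b = b} a≤b = transposeˡ (trans a≤b (unit b))

    h-mono : ∀ {a b} → a ≤ b → h a ≤ h b
    h-mono {a} a≤b = transposeʳ (trans (counit a) a≤b)

  module SClosure {ℓS : Level} {S : Pred (Pair 𝐋) ℓS} {C : Carrier → Carrier}
                  (isClosure : IsSClosure 𝐋 S C) where
    open IsSClosure isClosure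

    ≤-closed⇒C≤ : ∀ {a b f h} → (f , h) ∈ S → a ≤ h (C b) → C a ≤ h (C b)
    ≤-closed⇒C≤ {a} {b} {f} {h} fh∈S a≤hCb =
      trans (monotone a (h (C b)) a≤hCb) (closed b f h fh∈S)

    C≤h∘C∘f : ∀ {f h} → (f , h) ∈ S → IsIsotoneGalois 𝐋 (f , h) →
              ∀ a → C a ≤ h (C (f a))
    C≤h∘C∘f fh∈S galois a =
      ≤-closed⇒C≤ fh∈S (trans (unit a) (h-mono (extensive _)))
      where open IsotoneGalois galois

    C∘h≤h∘C : ∀ {f h} → (f , h) ∈ S → IsIsotoneGalois 𝐋 (f , h) →
              ∀ a → C (h a) ≤ h (C a)
    C∘h≤h∘C fh∈S galois a = ≤-closed⇒C≤ fh∈S (h-mono (extensive a))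
      where open IsotoneGalois galois

theorem35 : {c ℓ₁ ℓ₂ ℓS : Level} (𝐋 : CompleteLattice c ℓ₁ ℓ₂)
    (S : Pred (Pair 𝐋) ℓS) → IsParameterization 𝐋 S
    → (C : CompleteLattice.Carrier 𝐋 → CompleteLattice.Carrier 𝐋)
    → IsSClosure 𝐋 S C
    → ∀ a f h → (f , h) ∈ S
    → (CompleteLattice._≤_ 𝐋 (f (C a)) (C (f a)))
    × (CompleteLattice._≤_ 𝐋 (C (h a)) (h (C a)))
    × (CompleteLattice._≤_ 𝐋 (f (C (h a))) (h (C (f a))))
theorem35 𝐋 S param C isClosure a f h fh∈S =
  f∘C≤C∘f , C∘h≤h∘C fh∈S galois a , f∘C∘h≤h∘C∘f
  where
  open CompleteLattice 𝐋
  open SClosure 𝐋 isClosure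
  galois : IsIsotoneGalois 𝐋 (f , h)
  galois = IsParameterization.galois param (f , h) fh∈S
  open IsotoneGalois 𝐋 galois

  f∘C≤C∘f : f (C a) ≤ C (f a)
  f∘C≤C∘f = transposeˡ (C≤h∘C∘f fh∈S galois a)

  f∘C∘h≤h∘C∘f : f (C (h a)) ≤ h (C (f a))
  f∘C∘h≤h∘C∘f =
    trans (f-mono (C∘h≤h∘C fh∈S galois a))
          (trans (counit (C a)) (C≤h∘C∘f fh∈S galois a))
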